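{- Let $K=(S,L,\to)$ be a Kripke structure (not necessarily finite) and $s,t\in S$. Then $s\approx_{dbs}t$ if and only if for every $\mathsf{CTL}^*_{ -\mathsf X}$ state formula $\varphi$: $s\models_{db}\varphi\iff t\models_{db}\varphi$.
   Context: Fix a set $AP$ of atomic propositions. Kripke structure: $(S,L,\to)$, $L:S\to2^{AP}$, $\to\subseteq S\times S$ (not necessarily total). A path from $s$ is a finite or infinite sequence $s_0,s_1,\dots$ with $s_0=s$, $s_k\to s_{k+1}$; suffixes are obtained by deleting a finite initial segment. $\mathsf{CTL}^*_{ -\mathsf X}$: state formulas $\varphi::=p\mid\neg\varphi\mid\bigwedge\Phi\mid\exists\psi$, path formulas $\psi::=\varphi\mid\neg\psi\mid\bigwedge\Psi\mid\psi\,\mathsf U\,\psi$ ($p\in AP$, $\Phi,\Psi$ arbitrary sets). Divergence blind validity $\models_{db}$: $s\models_{db}p$ iff $p\in L(s)$; $\neg,\bigwedge$ as usual; $s\models_{db}\exists\psi$ iff some path (not necessarily maximal) $\pi$ from $s$ has $\pi\models_{db}\psi$; a path satisfies a state formula iff its first state does; $\pi\models_{db}\psi\,\mathsf U\,\psi'$ iff some suffix $\pi'$ of $\pi$ satisfies $\psi'$ and every suffix $\pi''$ of $\pi$ having $\pi'$ as proper suffix satisfies $\psi$. A colouring is a function $\mathcal C:S\to\mathbf C$; for a path $\pi$, $\mathcal C(\pi)$ is the sequence of colours of its states with every finite or infinite maximal block of equal consecutive colours contracted to one occurrence, called a $\mathcal C$-coloured trace of the first state of $\pi$. $\mathcal C$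 is consistent if any two states of the same colour satisfy the same atomic propositions and have the same $\mathcal C$-coloured traces. $s\approx_{dbs}t$ iff some consistent colouring $\mathcal C$ has $\mathcal C(s)=\mathcal C(t)$. -}

module Defs where

open import Level using (Level; 0ℓ; _⊔_) renaming (suc to lsuc)
open import Data.Nat using (ℕ; zero; suc; _+_; _∸_; _≤_; _<_)
open import Data.Nat.Properties using (m≤o∸n⇒m+n≤o)
open import Data.Unit using (⊤; tt)
open import Data.Product using (Σ; Σ-syntax; ∃; ∃-syntax; _×_; _,_)
open import Data.Sum using (_⊎_)
open import Relation.Nullary using (¬_)
open import Relation.Binary.PropositionalEquality using (_≡_)
open import Relation.Binary.Bundles using (Setoid)
open import Function.Bundles using (_⇔_)

-- Kripke structures over a set AP of atomic propositions.
-- L s p  means  p ∈ L(s).  The transition relation need not be total.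

record Kripke (AP : Set) : Set₁ where
  field
    S   : Set
    L   : S → AP → Set
    _⟶_ : S → S → Set

-- Lengths of (finite or infinite) sequences.
-- fin n : the sequence has the n+1 positions 0..n;  inf : positions are all of ℕ.

data Len : Set where
  fin : ℕ → Len
  inf : Len

Valid : Len → ℕ → Set
Valid (fin n) i = i ≤ n
Valid inf     i = ⊤

dropLen : Len → ℕ → Len
dropLen (fin n) k = fin (n ∸ k)
dropLen inf     k = inf

valid-drop : ∀ l k i → Valid l k → Valid (dropLen l k) i → Valid l (i + k)
valid-drop (fin n) k i k≤n v = m≤o∸n⇒m+n≤o i k≤n v
valid-drop inf     k i _   _ = tt

module _ {AP : Set} (K : Kripke AP) where
  open Kripke K

  -- Paths: nonempty finite or infinite sequences s₀,s₁,… with sᵢ ⟶ sᵢ₊₁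
  -- (values of  at  outside the valid positions are irrelevant).
  record Path : Set where
    field
      len  : Len
      at   : ℕ → S
      step : ∀ i → Valid len (suc i) → at i ⟶ at (suc i)
  open Path public

  first : Path → S
  first π = at π 0

  drop : (π : Path) (k : ℕ) → Valid (len π) k → Path
  drop π k vk = record
    { len  = dropLen (len π) k
    ; at   = λ i → at π (i + k)
    ; step = λ i v → step π (i + k) (valid-drop (len π) k (suc i) vk v)
    }

  -- Coloured traces.  A colouring takes values in a set of colours,
  -- rendered as a setoid (colours compared by its equality _≈_).
  record Colouring (c ℓ : Level) : Set (lsuc (c ⊔ ℓ)) where
    field
      Colours : Setoid c ℓ
      colour  : S → Setoid.Carrier Colours

  module _ {c ℓ : Level} (𝒞 : Colouring c ℓ) where
    open Colouring 𝒞
    open Setoid Colours using (Carrier; _≈_)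

    record Trace : Set c where
      field
        tlen : Len
        tcol : ℕ → Carrier
    open Trace

    -- IsContraction π τ :  τ = 𝒞(π), i.e. τ is the colour sequence of π with
    -- every (finite or infinite) maximal block of equal consecutive colours
    -- contracted to one occurrence.  g maps each position of π to the index of
    -- its block in τ.
    IsContraction : Path → Trace → Set ℓ
    IsContraction π τ =
      Σ[ g ∈ (ℕ → ℕ) ]
        ( g 0 ≡ 0
        × (∀ i → Valid (len π) i → Valid (tlen τ) (g i))
        × (∀ i → Valid (len π) (suc i) → (g (suc i) ≡ g i) ⊎ (g (suc i) ≡ suc (g i)))
        × (∀ j → Valid (tlen τ) j → Σ[ i ∈ ℕ ] (Valid (len π) i × g i ≡ j))
        × (∀ i → Valid (len π) i → colour (at π i) ≈ tcol τ (g i))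
        × (∀ j → Valid (tlen τ) (suc j) → ¬ (tcol τ j ≈ tcol τ (suc j))) )

    IsTraceOf : S → Trace → Set ℓ
    IsTraceOf s τ = Σ[ π ∈ Path ] (first π ≡ s × IsContraction π τ)

    Consistent : Set (c ⊔ ℓ)
    Consistent = ∀ s t → colour s ≈ colour t →
      (∀ p → L s p ⇔ L t p) × (∀ τ → IsTraceOf s τ ⇔ IsTraceOf t τ)

  -- divergence-blind stuttering bisimilarity
  -- (colours and their equality live in Set₁)
  _≈dbs_ : S → S → Set₂
  s ≈dbs t = Σ[ 𝒞 ∈ Colouring (lsuc 0ℓ) (lsuc 0ℓ) ]
    (Consistent 𝒞 × Setoid._≈_ (Colouring.Colours 𝒞) (Colouring.colour 𝒞 s) (Colouring.colour 𝒞 t))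

-- CTL*₋X syntax; conjunctions over arbitrary (small) index sets.

mutual
  data StateF (AP : Set) : Set₁ where
    atom : AP → StateF AP
    ¬ₛ_  : StateF AP → StateF AP
    ⋀ₛ   : (I : Set) → (I → StateF AP) → StateF AP
    ∃ₚ   : PathF AP → StateF AP

  data PathF (AP : Set) : Set₁ where
    stf  : StateF AP → PathF AP
    ¬ₚ_  : PathF AP → PathF AP
    ⋀ₚ   : (I : Set) → (I → PathF AP) → PathF AP
    _U_  : PathF AP → PathF AP → PathF AP

module _ {AP : Set} (K : Kripke AP) where
  open Kripke K

  mutual
    _⊨ₛ_ : S → StateF AP → Set
    s ⊨ₛ atom p   = L s p
    s ⊨ₛ (¬ₛ φ)   = ¬ (s ⊨ₛ φ)
    s ⊨ₛ ⋀ₛ I Φ   = ∀ i → s ⊨ₛ Φ i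
    s ⊨ₛ ∃ₚ ψ     = Σ[ π ∈ Path K ] (first K π ≡ s × π ⊨ₚ ψ)

    _⊨ₚ_ : Path K → PathF AP → Set
    π ⊨ₚ stf φ    = first K π ⊨ₛ φ
    π ⊨ₚ (¬ₚ ψ)   = ¬ (π ⊨ₚ ψ)
    π ⊨ₚ ⋀ₚ I Ψ   = ∀ i → π ⊨ₚ Ψ i
    π ⊨ₚ (ψ U ψ′) = Σ[ k ∈ ℕ ] Σ[ vk ∈ Valid (len π) k ]
        ( drop K π k vk ⊨ₚ ψ′
        × (∀ j (vj : Valid (len π) j) → j < k → drop K π j vj ⊨ₚ ψ) )

-- Soundness: under excluded middle every path contracts to a coloured trace, and whether a path satisfies a
-- path formula depends only on that trace, because the suffixes of two paths with the same trace can be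
-- matched block by block.  Hence, by mutual induction on formulas, states of the same colour under a
-- consistent colouring satisfy the same formulas.
-- Completeness: colour states by logical equivalence.  Each class has a characteristic formula χ (a
-- conjunction of separating formulas), and a stutter-free trace c₀ c₁ … has a formula
-- χc₀ U (χc₁ U …) satisfied by exactly the paths contracting to it; its ∃-closure carries traces of a
-- state over to every logically equivalent state, so this colouring is consistent.
module Submission where

open import Defs
open import Level using (Level; 0ℓ; _⊔_; Lift; lift; lower) renaming (suc to lsuc)
open import Axiom.ExcludedMiddle using (ExcludedMiddle)
open import Function.Base using (_on_)
open import Function.Bundles using (_⇔_; Equivalence; mk⇔)
open import Function.Properties.Equivalence using (⇔-isEquivalence)
open import Data.Bool using (Bool; true; false; if_then_else_)
open import Data.Empty using (⊥; ⊥-elim)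
open import Data.Nat using (ℕ; zero; suc; _+_; _∸_; _≤_; _<_; z≤n; s≤s; _≤?_)
open import Data.Nat.Properties
open import Data.Product using (Σ-syntax; _×_; _,_; proj₁; proj₂)
open import Data.Sum using (_⊎_; inj₁; inj₂)
open import Data.Unit using (tt)
open import Relation.Nullary using (¬_; Dec; yes; no)
open import Relation.Nullary.Decidable using (map′; decidable-stable)
open import Relation.Binary.PropositionalEquality
open import Relation.Binary.Bundles using (Setoid)
open import Relation.Binary.Structures using (IsEquivalence)
import Relation.Binary.Construct.On as On

em-lower : ∀ {a b} → ExcludedMiddle (a ⊔ b) → ExcludedMiddle a
em-lower {b = b} em {P} = map′ lower lift (em {Lift b P})

valid-zero : ∀ l → Valid l 0
valid-zero (fin n) = z≤n
valid-zero inf     = tt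

valid-≤ : ∀ l {i j} → i ≤ j → Valid l j → Valid l i
valid-≤ (fin n) i≤j j≤n = ≤-trans i≤j j≤n
valid-≤ inf     _   _   = tt

valid-pred : ∀ l {i} → Valid l (suc i) → Valid l i
valid-pred l = valid-≤ l (n≤1+n _)

valid-∸ : ∀ l k {i} → Valid l i → Valid (dropLen l k) (i ∸ k)
valid-∸ (fin n) k i≤n = ∸-monoˡ-≤ k i≤n
valid-∸ inf     k _   = tt

valid-everywhere⇒inf : ∀ l → (∀ i → Valid l i) → l ≡ inf
valid-everywhere⇒inf (fin n) valid = ⊥-elim (1+n≰n (valid (suc n)))
valid-everywhere⇒inf inf     _     = refl

dropLen-zero : ∀ l → dropLen l 0 ≡ l
dropLen-zero (fin n) = refl
dropLen-zero inf     = refl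

dropLen-dropLen : ∀ l i k → dropLen (dropLen l i) k ≡ dropLen l (k + i)
dropLen-dropLen (fin n) i k = cong fin (trans (∸-+-assoc n i k) (cong (n ∸_) (+-comm i k)))
dropLen-dropLen inf     i k = refl

-- Step functions

IsStepFunction : Len → (ℕ → ℕ) → Set
IsStepFunction l g = ∀ i → Valid l (suc i) → g (suc i) ≡ g i ⊎ g (suc i) ≡ suc (g i)

module StepFunction {l : Len} {g : ℕ → ℕ} (step : IsStepFunction l g) where

  step-≤ : ∀ i → Valid l (suc i) → g i ≤ g (suc i)
  step-≤ i v with step i v
  ... | inj₁ same = ≤-reflexive (sym same)
  ... | inj₂ up   = subst (g i ≤_) (sym up) (n≤1+n (g i))

  step-≤1+ : ∀ i → Valid l (suc i) → g (suc i) ≤ suc (g i)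
  step-≤1+ i v with step i v
  ... | inj₁ same = subst (_≤ suc (g i)) (sym same) (n≤1+n (g i))
  ... | inj₂ up   = ≤-reflexive up

  monotone : ∀ {i j} → i ≤ j → Valid l j → g i ≤ g j
  monotone {j = zero}  z≤n   _ = ≤-refl
  monotone {j = suc j} i≤1+j v with m≤n⇒m<n∨m≡n i≤1+j
  ... | inj₁ i<1+j = ≤-trans (monotone (≤-pred i<1+j) (valid-pred l v)) (step-≤ j v)
  ... | inj₂ refl  = ≤-refl

  first-hit : ∀ {b} i → Valid l i → g i ≡ b →
    Σ[ k ∈ ℕ ] (k ≤ i × g k ≡ b × (∀ j → j < k → g j < b))
  first-hit zero    _ g0≡b = zero , z≤n , g0≡b , λ _ ()
  first-hit (suc i) v gi+1≡b with step i v
  ... | inj₁ same =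
    let k , k≤i , gk≡b , earlier = first-hit i (valid-pred l v) (trans (sym same) gi+1≡b)
    in  k , m≤n⇒m≤1+n k≤i , gk≡b , earlier
  ... | inj₂ up =
    suc i , ≤-refl , gi+1≡b ,
    λ j j<1+i → subst (g j <_) (trans (sym up) gi+1≡b)
                  (s≤s (monotone (≤-pred j<1+i) (valid-pred l v)))

  intermediate-value : ∀ n {j} → Valid l n → g 0 ≤ j → j ≤ g n →
    Σ[ i ∈ ℕ ] (i ≤ n × g i ≡ j)
  intermediate-value zero    _ g0≤j j≤g0 = zero , z≤n , ≤-antisym g0≤j j≤g0
  intermediate-value (suc n) {j} v g0≤j j≤gn+1 with j ≤? g n
  ... | yes j≤gn =
    let i , i≤n , gi≡j = intermediate-value n (valid-pred l v) g0≤j j≤gn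
    in  i , m≤n⇒m≤1+n i≤n , gi≡j
  ... | no j≰gn = suc n , ≤-refl , ≤-antisym (≤-trans (step-≤1+ n v) (≰⇒> j≰gn)) j≤gn+1

  up-crossing : ∀ i {j} → Valid l i → g 0 ≤ j → g i ≡ suc j →
    Σ[ k ∈ ℕ ] (g k ≡ j × g (suc k) ≡ suc j)
  up-crossing zero    _ g0≤j g0≡1+j = ⊥-elim (1+n≰n (subst (_≤ _) g0≡1+j g0≤j))
  up-crossing (suc i) v g0≤j gi+1≡1+j with step i v
  ... | inj₁ same = up-crossing i (valid-pred l v) g0≤j (trans (sym same) gi+1≡1+j)
  ... | inj₂ up   = i , suc-injective (trans (sym up) gi+1≡1+j) , gi+1≡1+j

open StepFunction

module _ {AP : Set} where

  _∧ₚ_ : PathF AP → PathF AP → PathF AP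
  ψ ∧ₚ ψ′ = ⋀ₚ Bool (λ b → if b then ψ else ψ′)

  ⊤ₚ : PathF AP
  ⊤ₚ = ⋀ₚ ⊥ (λ ())

  □ : PathF AP → PathF AP
  □ ψ = ¬ₚ (⊤ₚ U (¬ₚ ψ))

  ⊤ₛ : StateF AP
  ⊤ₛ = ⋀ₛ ⊥ (λ ())

module _ {AP : Set} (K : Kripke AP) where
  open Kripke K

  infix 4 _⊨_ _⊩_ _≈ₚ_

  _⊨_ : S → StateF AP → Set
  _⊨_ = _⊨ₛ_ K

  _⊩_ : Path K → PathF AP → Set
  _⊩_ = _⊨ₚ_ K

  record _≈ₚ_ (π π′ : Path K) : Set where
    constructor _,_
    field
      same-len : len π ≡ len π′
      same-at  : ∀ i → at π i ≡ at π′ i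

  ≈ₚ-refl : ∀ {π} → π ≈ₚ π
  ≈ₚ-refl = refl , λ _ → refl

  ≈ₚ-sym : ∀ {π π′} → π ≈ₚ π′ → π′ ≈ₚ π
  ≈ₚ-sym (same-len , same-at) = sym same-len , λ i → sym (same-at i)

  ≈ₚ-trans : ∀ {π π′ π″} → π ≈ₚ π′ → π′ ≈ₚ π″ → π ≈ₚ π″
  ≈ₚ-trans (l₁ , at₁) (l₂ , at₂) = trans l₁ l₂ , λ i → trans (at₁ i) (at₂ i)

  valid-≈ₚ : ∀ {π π′ i} → π ≈ₚ π′ → Valid (len π) i → Valid (len π′) i
  valid-≈ₚ {i = i} (same-len , _) = subst (λ l → Valid l i) same-len

  drop-≈ₚ : ∀ {π π′ i j} → π ≈ₚ π′ → i ≡ j →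
    (vi : Valid (len π) i) (vj : Valid (len π′) j) → drop K π i vi ≈ₚ drop K π′ j vj
  drop-≈ₚ {i = i} (same-len , same-at) refl _ _ =
    cong (λ l → dropLen l i) same-len , λ n → same-at (n + i)

  drop-zero : ∀ π → drop K π 0 (valid-zero (len π)) ≈ₚ π
  drop-zero π = dropLen-zero (len π) , λ n → cong (at π) (+-identityʳ n)

  drop-drop : ∀ π {i k} (vi : Valid (len π) i) (vk : Valid (dropLen (len π) i) k) →
    drop K (drop K π i vi) k vk ≈ₚ drop K π (k + i) (valid-drop (len π) i k vi vk)
  drop-drop π {i} {k} _ _ = dropLen-dropLen (len π) i k , λ n → cong (at π) (+-assoc n k i)

  drop-drop-∸ : ∀ π {i k} (vi : Valid (len π) i) (vk : Valid (len π) k) → i ≤ k →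
    drop K (drop K π i vi) (k ∸ i) (valid-∸ (len π) i vk) ≈ₚ drop K π k vk
  drop-drop-∸ π vi vk i≤k =
    ≈ₚ-trans (drop-drop π vi _) (drop-≈ₚ {π} ≈ₚ-refl (m∸n+n≡m i≤k) _ vk)

  ⊩-resp-≈ₚ : ∀ ψ {π π′} → π ≈ₚ π′ → π ⊩ ψ → π′ ⊩ ψ
  ⊩-resp-≈ₚ (stf φ)  (_ , same-at) h = subst (_⊨ φ) (same-at 0) h
  ⊩-resp-≈ₚ (¬ₚ ψ)   π≈π′ h h′ = h (⊩-resp-≈ₚ ψ (≈ₚ-sym π≈π′) h′)
  ⊩-resp-≈ₚ (⋀ₚ I Ψ) π≈π′ h i = ⊩-resp-≈ₚ (Ψ i) π≈π′ (h i)
  ⊩-resp-≈ₚ (ψ U ψ′) π≈π′ (k , vk , now , before) =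
    k , valid-≈ₚ π≈π′ vk ,
    ⊩-resp-≈ₚ ψ′ (drop-≈ₚ π≈π′ refl vk (valid-≈ₚ π≈π′ vk)) now ,
    λ j vj j<k → let vj₀ = valid-≈ₚ (≈ₚ-sym π≈π′) vj in
      ⊩-resp-≈ₚ ψ (drop-≈ₚ π≈π′ refl vj₀ vj) (before j vj₀ j<k)

  -- Until and always, read off at absolute positions of a path

  ∧ₚ-intro : ∀ {π ψ ψ′} → π ⊩ ψ → π ⊩ ψ′ → π ⊩ ψ ∧ₚ ψ′
  ∧ₚ-intro h h′ true  = h
  ∧ₚ-intro h h′ false = h′

  U-intro : ∀ {π ψ ψ′ i k} (vi : Valid (len π) i) (vk : Valid (len π) k) → i ≤ k →
    drop K π k vk ⊩ ψ′ →
    (∀ m (vm : Valid (len π) m) → i ≤ m → m < k → drop K π m vm ⊩ ψ) →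
    drop K π i vi ⊩ ψ U ψ′
  U-intro {π} {ψ} {ψ′} {i} {k} vi vk i≤k now before =
    k ∸ i , valid-∸ (len π) i vk ,
    ⊩-resp-≈ₚ ψ′ (≈ₚ-sym (drop-drop-∸ π vi vk i≤k)) now ,
    λ m vm m<k∸i → ⊩-resp-≈ₚ ψ (≈ₚ-sym (drop-drop π vi vm))
      (before (m + i) (valid-drop (len π) i m vi vm) (m≤n+m i m)
        (subst (m + i <_) (m∸n+n≡m i≤k) (+-monoˡ-< i m<k∸i)))

  U-elim : ∀ {π ψ ψ′ i} (vi : Valid (len π) i) → drop K π i vi ⊩ ψ U ψ′ →
    Σ[ k ∈ ℕ ] Σ[ vk ∈ Valid (len π) k ]
      (i ≤ k × drop K π k vk ⊩ ψ′ ×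
       (∀ m (vm : Valid (len π) m) → i ≤ m → m < k → drop K π m vm ⊩ ψ))
  U-elim {π} {ψ} {ψ′} {i} vi (k , vk , now , before) =
    k + i , valid-drop (len π) i k vi vk , m≤n+m i k , ⊩-resp-≈ₚ ψ′ (drop-drop π vi vk) now ,
    λ m vm i≤m m<k+i → ⊩-resp-≈ₚ ψ (drop-drop-∸ π vi vm i≤m)
      (before (m ∸ i) (valid-∸ (len π) i vm)
        (subst (m ∸ i <_) (m+n∸n≡m k i) (∸-monoˡ-< m<k+i i≤m)))

  □-intro : ∀ {π ψ i} (vi : Valid (len π) i) →
    (∀ m (vm : Valid (len π) m) → i ≤ m → drop K π m vm ⊩ ψ) → drop K π i vi ⊩ □ ψ
  □-intro {π} {ψ} vi always eventually-not =
    let m , vm , i≤m , not-now , _ = U-elim {π} {⊤ₚ} {¬ₚ ψ} vi eventually-not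
    in  not-now (always m vm i≤m)

  □-elim : ∀ {π ψ i m} (vi : Valid (len π) i) (vm : Valid (len π) m) → i ≤ m →
    drop K π i vi ⊩ □ ψ → ¬ ¬ (drop K π m vm ⊩ ψ)
  □-elim {π} {ψ} vi vm i≤m always not-now =
    always (U-intro {π} {⊤ₚ} {¬ₚ ψ} vi vm i≤m not-now (λ _ _ _ _ ()))

  -- Coloured traces

  module _ {c ℓ : Level} (𝒞 : Colouring K c ℓ) where
    open Colouring 𝒞
    open Setoid Colours using (_≈_) renaming (refl to ≈-refl; sym to ≈-sym; trans to ≈-trans)
    open Trace

    dropTrace : Trace K 𝒞 → ℕ → Trace K 𝒞
    dropTrace τ b = record { tlen = dropLen (tlen τ) b ; tcol = λ j → tcol τ (j + b) }

    StutterFree : Trace K 𝒞 → Set ℓ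
    StutterFree τ = ∀ j → Valid (tlen τ) (suc j) → ¬ (tcol τ j ≈ tcol τ (suc j))

    module Contraction {π τ} (c : IsContraction K 𝒞 π τ) where
      block : ℕ → ℕ
      block = proj₁ c

      block-zero : block 0 ≡ 0
      block-zero = proj₁ (proj₂ c)

      block-valid : ∀ i → Valid (len π) i → Valid (tlen τ) (block i)
      block-valid = proj₁ (proj₂ (proj₂ c))

      block-step : IsStepFunction (len π) block
      block-step = proj₁ (proj₂ (proj₂ (proj₂ c)))

      block-onto : ∀ j → Valid (tlen τ) j → Σ[ i ∈ ℕ ] (Valid (len π) i × block i ≡ j)
      block-onto = proj₁ (proj₂ (proj₂ (proj₂ (proj₂ c))))

      block-colour : ∀ i → Valid (len π) i → colour (at π i) ≈ tcol τ (block i)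
      block-colour = proj₁ (proj₂ (proj₂ (proj₂ (proj₂ (proj₂ c)))))

      stutter-free : StutterFree τ
      stutter-free = proj₂ (proj₂ (proj₂ (proj₂ (proj₂ (proj₂ c)))))

      colour-in-block : ∀ {i b} → Valid (len π) i → block i ≡ b → colour (at π i) ≈ tcol τ b
      colour-in-block {i} vi refl = block-colour i vi

      colour-first : colour (first K π) ≈ tcol τ 0
      colour-first = colour-in-block (valid-zero _) block-zero

      stays : ∀ n → Valid (len π) (suc n) → colour (at π n) ≈ colour (at π (suc n)) →
        block (suc n) ≡ block n
      stays n v same with block-step n v
      ... | inj₁ same-block = same-block
      ... | inj₂ next-block = ⊥-elim (stutter-free (block n)
              (subst (Valid (tlen τ)) next-block (block-valid (suc n) v))
              (≈-trans (≈-sym (block-colour n (valid-pred _ v)))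
                       (≈-trans same (colour-in-block v next-block))))

      moves : ∀ n → Valid (len π) (suc n) → ¬ colour (at π n) ≈ colour (at π (suc n)) →
        block (suc n) ≡ suc (block n)
      moves n v different with block-step n v
      ... | inj₂ next-block = next-block
      ... | inj₁ same-block = ⊥-elim (different
              (≈-trans (block-colour n (valid-pred _ v)) (≈-sym (colour-in-block v same-block))))

      trace-length : ∀ {m} → Valid (tlen τ) m → (∀ i → Valid (len π) i → block i ≤ m) →
        tlen τ ≡ fin m
      trace-length = bounded (tlen τ) block-onto
        where
          bounded : ∀ l {m} →
            (∀ j → Valid l j → Σ[ i ∈ ℕ ] (Valid (len π) i × block i ≡ j)) →
            Valid l m → (∀ i → Valid (len π) i → block i ≤ m) → l ≡ fin m
          bounded (fin n) onto m≤n below with onto n ≤-refl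
          ... | i , vi , bi≡n = cong fin (≤-antisym (subst (_≤ _) bi≡n (below i vi)) m≤n)
          bounded inf {m} onto _ below with onto (suc m) tt
          ... | i , vi , bi≡1+m = ⊥-elim (1+n≰n (subst (_≤ m) bi≡1+m (below i vi)))

    contraction-drop : ∀ {π τ k b} (c : IsContraction K 𝒞 π τ) (vk : Valid (len π) k) →
      proj₁ c k ≡ b → IsContraction K 𝒞 (drop K π k vk) (dropTrace τ b)
    contraction-drop {π} {τ} {k} c@(g , _ , gv , gs , gsu , gc , gd) vk refl =
        g′ , n∸n≡0 (g k) , valid′ , step′ , onto′ , colour′ , stutter-free′
      where
        b = g k
        valid-k : ∀ i → Valid (dropLen (len π) k) i → Valid (len π) (i + k)
        valid-k i = valid-drop (len π) k i vk
        b≤ : ∀ i → Valid (dropLen (len π) k) i → b ≤ g (i + k)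
        b≤ i v = monotone gs (m≤n+m k i) (valid-k i v)
        g′ : ℕ → ℕ
        g′ i = g (i + k) ∸ b
        valid′ : ∀ i → Valid (dropLen (len π) k) i → Valid (dropLen (tlen τ) b) (g′ i)
        valid′ i v = valid-∸ (tlen τ) b (gv (i + k) (valid-k i v))
        step′ : IsStepFunction (dropLen (len π) k) g′
        step′ i v with gs (i + k) (valid-k (suc i) v)
        ... | inj₁ same = inj₁ (cong (_∸ b) same)
        ... | inj₂ up   = inj₂ (trans (cong (_∸ b) up) (+-∸-assoc 1 (b≤ i (valid-pred _ v))))
        onto′ : ∀ j → Valid (dropLen (tlen τ) b) j →
          Σ[ i ∈ ℕ ] (Valid (dropLen (len π) k) i × g′ i ≡ j)
        onto′ zero    _ = 0 , valid-zero _ , n∸n≡0 b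
        onto′ (suc j) v with gsu (suc j + b) (valid-drop (tlen τ) b (suc j) (gv k vk) v)
        ... | i , vi , gi≡ with k ≤? i
        ...   | yes k≤i = i ∸ k , valid-∸ (len π) k vi ,
                  trans (cong (λ x → g x ∸ b) (m∸n+n≡m k≤i))
                        (trans (cong (_∸ b) gi≡) (m+n∸n≡m (suc j) b))
        ...   | no k≰i = ⊥-elim (1+n≰n (≤-trans (s≤s (m≤n+m b j))
                  (subst (_≤ b) gi≡ (monotone gs (<⇒≤ (≰⇒> k≰i)) vk))))
        colour′ : ∀ i → Valid (dropLen (len π) k) i → colour (at π (i + k)) ≈ tcol τ (g′ i + b)
        colour′ i v = subst (λ x → colour (at π (i + k)) ≈ tcol τ x)
                        (sym (m∸n+n≡m (b≤ i v))) (gc (i + k) (valid-k i v))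
        stutter-free′ : StutterFree (dropTrace τ b)
        stutter-free′ j v = gd (j + b) (valid-drop (tlen τ) b (suc j) (gv k vk) v)

    contraction-resp : ∀ {π τ τ′} → IsContraction K 𝒞 π τ → tlen τ ≡ tlen τ′ →
      (∀ j → Valid (tlen τ′) j → tcol τ j ≈ tcol τ′ j) → StutterFree τ′ →
      IsContraction K 𝒞 π τ′
    contraction-resp {π} {τ} {τ′} (g , g0 , gv , gs , gsu , gc , _) same-len same-col stutter-free′ =
      g , g0 , (λ i vi → valid′ (gv i vi)) , gs ,
      (λ j vj → gsu j (subst (λ l → Valid l j) (sym same-len) vj)) ,
      (λ i vi → ≈-trans (gc i vi) (same-col (g i) (valid′ (gv i vi)))) ,
      stutter-free′
      where
        valid′ : ∀ {j} → Valid (tlen τ) j → Valid (tlen τ′) j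
        valid′ {j} = subst (λ l → Valid l j) same-len

    module CanonicalContraction (em : ExcludedMiddle ℓ) (a : ℕ → S) where

      decide : {P : Set} → Dec P
      decide = em-lower em

      block : ℕ → ℕ
      block zero    = zero
      block (suc i) with em {colour (a (suc i)) ≈ colour (a i)}
      ... | yes _ = block i
      ... | no  _ = suc (block i)

      block-cases : ∀ i →
        (block (suc i) ≡ block i × colour (a (suc i)) ≈ colour (a i)) ⊎
        (block (suc i) ≡ suc (block i) × ¬ colour (a (suc i)) ≈ colour (a i))
      block-cases i with em {colour (a (suc i)) ≈ colour (a i)}
      ... | yes same      = inj₁ (refl , same)
      ... | no  different = inj₂ (refl , different)

      block-step : ∀ {l} → IsStepFunction l block
      block-step i _ with block-cases i
      ... | inj₁ (same-block , _) = inj₁ same-block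
      ... | inj₂ (next-block , _) = inj₂ next-block

      stays⁻ : ∀ i → block (suc i) ≡ block i → colour (a (suc i)) ≈ colour (a i)
      stays⁻ i same-block with block-cases i
      ... | inj₁ (_ , same)       = same
      ... | inj₂ (next-block , _) = ⊥-elim (1+n≢n (trans (sym next-block) same-block))

      moves⁻ : ∀ i → block (suc i) ≡ suc (block i) → ¬ colour (a (suc i)) ≈ colour (a i)
      moves⁻ i next-block with block-cases i
      ... | inj₁ (same-block , _) = ⊥-elim (1+n≢n (trans (sym next-block) same-block))
      ... | inj₂ (_ , different)  = different

      same-block-same-colour≤ : ∀ {i j} → i ≤ j → block i ≡ block j →
        colour (a j) ≈ colour (a i)
      same-block-same-colour≤ {j = zero}  z≤n   _ = ≈-refl
      same-block-same-colour≤ {i} {suc j} i≤1+j bi≡bj+1 with m≤n⇒m<n∨m≡n i≤1+j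
      ... | inj₂ refl  = ≈-refl
      ... | inj₁ i<1+j = ≈-trans (stays⁻ j (sym bj≡bj+1)) (same-block-same-colour≤ i≤j bi≡bj)
        where
          i≤j = ≤-pred i<1+j
          bj≤bi : block j ≤ block i
          bj≤bi = subst (block j ≤_) (sym bi≡bj+1) (step-≤ (block-step {inf}) j tt)
          bi≡bj = ≤-antisym (monotone (block-step {inf}) i≤j tt) bj≤bi
          bj≡bj+1 = trans (sym bi≡bj) bi≡bj+1

      same-block-same-colour : ∀ {i j} → block i ≡ block j → colour (a i) ≈ colour (a j)
      same-block-same-colour {i} {j} bi≡bj with ≤-total i j
      ... | inj₁ i≤j = ≈-sym (same-block-same-colour≤ i≤j bi≡bj)
      ... | inj₂ j≤i = same-block-same-colour≤ j≤i (sym bi≡bj)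

      AttainsMax : Set
      AttainsMax = Σ[ i ∈ ℕ ] (∀ i′ → block i′ ≤ block i)

      bounded⇒attains-max : ∀ b → (∀ i → block i ≤ b) → AttainsMax
      bounded⇒attains-max zero    below = 0 , below
      bounded⇒attains-max (suc b) below with decide {Σ[ i ∈ ℕ ] block i ≡ suc b}
      ... | yes (i , bi≡1+b) = i , λ i′ → subst (block i′ ≤_) (sym bi≡1+b) (below i′)
      ... | no  never        =
        bounded⇒attains-max b λ i → ≤-pred (≤∧≢⇒< (below i) (λ bi≡1+b → never (i , bi≡1+b)))

      traceLen : Len → Len
      traceLen (fin n) = fin (block n)
      traceLen inf with decide {AttainsMax}
      ... | yes (i , _) = fin (block i)
      ... | no  _       = inf

      -- Junk value 0 when no position lies in block j.
      representative : ℕ → ℕ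
      representative j with decide {Σ[ i ∈ ℕ ] block i ≡ j}
      ... | yes (i , _) = i
      ... | no  _       = 0

      representative-block : ∀ i {j} → block i ≡ j → block (representative j) ≡ j
      representative-block i {j} bi≡j with decide {Σ[ i ∈ ℕ ] block i ≡ j}
      ... | yes (_ , e) = e
      ... | no  never   = ⊥-elim (never (i , bi≡j))

      trace : Len → Trace K 𝒞
      trace l = record { tlen = traceLen l ; tcol = λ j → colour (a (representative j)) }

      block-valid : ∀ l i → Valid l i → Valid (traceLen l) (block i)
      block-valid (fin n) i i≤n = monotone (block-step {inf}) i≤n tt
      block-valid inf     i _ with decide {AttainsMax}
      ... | yes (_ , max) = max i
      ... | no  _         = tt

      reaches : ∀ l {j} → Valid (traceLen l) j → Σ[ i ∈ ℕ ] (Valid l i × j ≤ block i)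
      reaches (fin n) j≤bn = n , ≤-refl , j≤bn
      reaches inf {j} v with decide {AttainsMax}
      ... | yes (i , _) = i , tt , v
      ... | no  no-max with decide {Σ[ i ∈ ℕ ] j ≤ block i}
      ...   | yes (i , j≤bi) = i , tt , j≤bi
      ...   | no  never      =
        ⊥-elim (no-max (bounded⇒attains-max j λ i → <⇒≤ (≰⇒> λ j≤bi → never (i , j≤bi))))

      block-onto : ∀ l j → Valid (traceLen l) j → Σ[ i ∈ ℕ ] (Valid l i × block i ≡ j)
      block-onto l j v =
        let n , vn , j≤bn = reaches l v
            i , i≤n , bi≡j = intermediate-value (block-step {inf}) n tt z≤n j≤bn
        in  i , valid-≤ l i≤n vn , bi≡j

      trace-stutter-free : ∀ l → StutterFree (trace l)
      trace-stutter-free l j v same with block-onto l (suc j) v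
      ... | i , _ , bi≡1+j with up-crossing (block-step {inf}) i tt z≤n bi≡1+j
      ...   | k , bk≡j , bk+1≡1+j = moves⁻ k (trans bk+1≡1+j (cong suc (sym bk≡j)))
          (≈-trans (same-block-same-colour (trans bk+1≡1+j (sym (representative-block (suc k) bk+1≡1+j))))
            (≈-trans (≈-sym same)
              (same-block-same-colour (trans (representative-block k bk≡j) (sym bk≡j)))))

    contraction : ExcludedMiddle ℓ → ∀ π → Σ[ τ ∈ Trace K 𝒞 ] IsContraction K 𝒞 π τ
    contraction em π =
      trace (len π) , block , refl , block-valid (len π) , block-step , block-onto (len π) ,
      (λ i _ → same-block-same-colour (sym (representative-block i refl))) , trace-stutter-free (len π)
      where open CanonicalContraction em (at π)

    module Preservation (em : ExcludedMiddle ℓ) (consistent : Consistent K 𝒞) where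

      mutual
        ⊨-resp-colour : ∀ φ {s t} → colour s ≈ colour t → s ⊨ φ → t ⊨ φ
        ⊨-resp-colour (atom p) s≈t h = Equivalence.to (proj₁ (consistent _ _ s≈t) p) h
        ⊨-resp-colour (¬ₛ φ)   s≈t h h′ = h (⊨-resp-colour φ (≈-sym s≈t) h′)
        ⊨-resp-colour (⋀ₛ I Φ) s≈t h i = ⊨-resp-colour (Φ i) s≈t (h i)
        ⊨-resp-colour (∃ₚ ψ) {s} {t} s≈t (π , π-from-s , h) =
          let τ , c = contraction em π
              π′ , π′-from-t , c′ =
                Equivalence.to (proj₂ (consistent s t s≈t) τ) (π , π-from-s , c)
          in  π′ , π′-from-t , ⊩-resp-trace ψ c c′ h

        ⊩-resp-trace : ∀ ψ {π π′ τ} → IsContraction K 𝒞 π τ → IsContraction K 𝒞 π′ τ →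
          π ⊩ ψ → π′ ⊩ ψ
        ⊩-resp-trace (stf φ) {π} {π′} {τ} c c′ h = ⊨-resp-colour φ
          (≈-trans (Contraction.colour-first {π} {τ} c)
                   (≈-sym (Contraction.colour-first {π′} {τ} c′))) h
        ⊩-resp-trace (¬ₚ ψ)   c c′ h h′ = h (⊩-resp-trace ψ c′ c h′)
        ⊩-resp-trace (⋀ₚ I Ψ) c c′ h i = ⊩-resp-trace (Ψ i) c c′ (h i)
        ⊩-resp-trace (ψ U ψ′) {π} {π′} {τ}
                     c@(g , _ , gv , gs , gsu , _) c′@(g′ , _ , gv′ , gs′ , gsu′ , _)
                     (k , vk , now , before)
          with gsu′ (g k) (gv k vk)
        ... | i′ , vi′ , g′i′≡gk with first-hit gs′ i′ vi′ g′i′≡gk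
        ...   | k′ , k′≤i′ , g′k′≡gk , earlier =
          k′ , vk′ , ⊩-resp-trace ψ′ (drop-c vk refl) (drop-c′ vk′ g′k′≡gk) now , before′
          where
            drop-c : ∀ {j b} (vj : Valid (len π) j) → g j ≡ b →
              IsContraction K 𝒞 (drop K π j vj) (dropTrace τ b)
            drop-c = contraction-drop {π} {τ} c
            drop-c′ : ∀ {j b} (vj : Valid (len π′) j) → g′ j ≡ b →
              IsContraction K 𝒞 (drop K π′ j vj) (dropTrace τ b)
            drop-c′ = contraction-drop {π′} {τ} c′
            vk′ = valid-≤ (len π′) k′≤i′ vi′
            before′ : ∀ j′ (vj′ : Valid (len π′) j′) → j′ < k′ → drop K π′ j′ vj′ ⊩ ψ
            before′ j′ vj′ j′<k′ with gsu (g′ j′) (gv′ j′ vj′)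
            ... | j , vj , gj≡g′j′ =
              ⊩-resp-trace ψ (drop-c vj gj≡g′j′) (drop-c′ vj′ refl) (before j vj j<k)
              where
                j<k : j < k
                j<k = ≰⇒> λ k≤j →
                  ≤⇒≯ (subst (g k ≤_) gj≡g′j′ (monotone gs k≤j vj)) (earlier j′ j′<k′)

  -- Logical equivalence is a consistent colouring

  module Completeness (em : ExcludedMiddle (lsuc 0ℓ)) where

    decide : {P : Set} → Dec P
    decide = em-lower em

    infix 4 _≋_
    _≋_ : S → S → Set₁
    u ≋ v = ∀ φ → u ⊨ φ ⇔ v ⊨ φ

    ≋-isEquivalence : IsEquivalence _≋_
    ≋-isEquivalence = record
      { refl  = λ _ → ⇔.refl
      ; sym   = λ u≋v φ → ⇔.sym (u≋v φ)
      ; trans = λ u≋v v≋w φ → ⇔.trans (u≋v φ) (v≋w φ)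
      }
      where module ⇔ = IsEquivalence ⇔-isEquivalence

    open IsEquivalence ≋-isEquivalence using ()
      renaming (refl to ≋-refl; sym to ≋-sym; trans to ≋-trans)

    𝒞≋ : Colouring K (lsuc 0ℓ) (lsuc 0ℓ)
    𝒞≋ = record
      { Colours = record
          { Carrier       = Lift (lsuc 0ℓ) S
          ; _≈_           = _≋_ on lower
          ; isEquivalence = On.isEquivalence lower ≋-isEquivalence
          }
      ; colour = lift
      }

    Separates : S → S → Set₁
    Separates u v = Σ[ φ ∈ StateF AP ] (u ⊨ φ × ¬ v ⊨ φ)

    separator : ∀ {u v} → Dec (Separates u v) → StateF AP
    separator (yes (φ , _)) = φ
    separator (no _)        = ⊤ₛ

    -- Characteristic formula of the ≋-class of u: the conjunction over all v of a formula that
    -- holds at u and fails at v, where one exists.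
    χ : S → StateF AP
    χ u = ⋀ₛ S (λ v → separator (em {Separates u v}))

    χ-self : ∀ u → u ⊨ χ u
    χ-self u v = holds (em {Separates u v})
      where
        holds : (d : Dec (Separates u v)) → u ⊨ separator d
        holds (yes (_ , uφ , _)) = uφ
        holds (no _)             = λ ()

    ¬separates⇒≋ : ∀ {u w} → ¬ Separates u w → u ≋ w
    ¬separates⇒≋ {u} {w} inseparable φ = mk⇔
      (λ uφ → decidable-stable decide (λ ¬wφ → inseparable (φ , uφ , ¬wφ)))
      (λ wφ → decidable-stable decide λ ¬uφ → inseparable (¬ₛ φ , ¬uφ , λ ¬wφ → ¬wφ wφ))

    χ⇒≋ : ∀ {u w} → w ⊨ χ u → u ≋ w
    χ⇒≋ {u} {w} h = separated (em {Separates u w}) (h w)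
      where
        separated : (d : Dec (Separates u w)) → w ⊨ separator d → u ≋ w
        separated (yes (_ , _ , ¬wφ)) wφ = ⊥-elim (¬wφ wφ)
        separated (no inseparable)    _  = ¬separates⇒≋ inseparable

    ≋⇒χ : ∀ {u w} → u ≋ w → w ⊨ χ u
    ≋⇒χ {u} u≋w = Equivalence.to (u≋w (χ u)) (χ-self u)

    χ-common⇒≋ : ∀ {u w w′} → w ⊨ χ u → w′ ⊨ χ u → w ≋ w′
    χ-common⇒≋ h h′ = ≋-trans (≋-sym (χ⇒≋ h)) (χ⇒≋ h′)

    χ-reflects-≋ : ∀ {u u′ w w′} → w ⊨ χ u → w′ ⊨ χ u′ → w ≋ w′ → u ≋ u′
    χ-reflects-≋ h h′ w≋w′ = ≋-trans (χ⇒≋ h) (≋-trans w≋w′ (≋-sym (χ⇒≋ h′)))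

    open Trace

    -- For a trace c₀ c₁ … c_m the formula is χc₀ ∧ (χc₀ U (χc₁ ∧ (χc₁ U … (χc_m ∧ □ χc_m)))); for an
    -- infinite trace it is the conjunction of the analogous formulas for all finite prefixes,
    -- without the final □.
    module TraceFormula (τ : Trace K 𝒞≋) where

      col : ℕ → S
      col j = lower (tcol τ j)

      inBlock : ℕ → PathF AP
      inBlock j = stf (χ (col j))

      chain : (ℕ → PathF AP) → ℕ → ℕ → PathF AP
      chain B zero    j = B j
      chain B (suc d) j = inBlock j ∧ₚ (inBlock j U chain B d (suc j))

      lastBlock : ℕ → PathF AP
      lastBlock j = inBlock j ∧ₚ □ (inBlock j)

      formulaFor : Len → PathF AP
      formulaFor (fin m) = chain lastBlock m 0
      formulaFor inf     = ⋀ₚ ℕ (λ n → chain inBlock n 0)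

      formula : PathF AP
      formula = formulaFor (tlen τ)

      Head : (ℕ → PathF AP) → Set
      Head B = ∀ x σ → σ ⊩ B x → first K σ ⊨ χ (col x)

      chain-head : ∀ B → Head B → ∀ d j σ → σ ⊩ chain B d j → first K σ ⊨ χ (col j)
      chain-head B head zero    j σ h = head j σ h
      chain-head B head (suc d) j σ h = h true

      module _ {π : Path K} (c : IsContraction K 𝒞≋ π τ) where
        open Contraction 𝒞≋ {π} {τ} c

        in-block : ∀ {i j} (vi : Valid (len π) i) → block i ≡ j → drop K π i vi ⊩ inBlock j
        in-block {i} vi refl = ≋⇒χ (≋-sym (block-colour i vi))

        contraction⇒chain : ∀ B d {j n i} (vi : Valid (len π) i) → block i ≡ j → d + j ≡ n →
          Valid (tlen τ) n →
          (∀ i′ (vi′ : Valid (len π) i′) → block i′ ≡ n → drop K π i′ vi′ ⊩ B n) →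
          drop K π i vi ⊩ chain B d j
        contraction⇒chain B zero _ bi≡j refl _ base = base _ _ bi≡j
        contraction⇒chain B (suc d) {j} {_} {i} vi bi≡j refl vn base
          with block-onto (suc j) (valid-≤ (tlen τ) (s≤s (m≤n+m j d)) vn)
        ... | i₁ , vi₁ , bi₁≡1+j with first-hit block-step i₁ vi₁ bi₁≡1+j
        ...   | k , k≤i₁ , bk≡1+j , earlier =
          ∧ₚ-intro (in-block vi bi≡j) (U-intro {π} {inBlock j} {chain B d (suc j)} vi vk i≤k
            (contraction⇒chain B d vk bk≡1+j (+-suc d j) vn base) during)
          where
            vk = valid-≤ (len π) k≤i₁ vi₁
            i≤k : i ≤ k
            i≤k = ≮⇒≥ λ k<i →
              1+n≰n (subst₂ _≤_ bk≡1+j bi≡j (monotone block-step (<⇒≤ k<i) vi))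
            during : ∀ m (vm : Valid (len π) m) → i ≤ m → m < k → drop K π m vm ⊩ inBlock j
            during m vm i≤m m<k = in-block vm (≤-antisym (≤-pred (earlier m m<k))
              (subst (_≤ block m) bi≡j (monotone block-step i≤m vm)))

        contraction⇒lastBlock : ∀ {m} → tlen τ ≡ fin m →
          ∀ i (vi : Valid (len π) i) → block i ≡ m → drop K π i vi ⊩ lastBlock m
        contraction⇒lastBlock {m} len≡m i vi bi≡m =
          ∧ₚ-intro (in-block vi bi≡m) (□-intro {π} {inBlock m} vi λ k vk i≤k → in-block vk
            (≤-antisym (subst (λ l → Valid l (block k)) len≡m (block-valid k vk))
                       (subst (_≤ block k) bi≡m (monotone block-step i≤k vk))))

        contraction⇒formula : ∀ l → tlen τ ≡ l → π ⊩ formulaFor l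
        contraction⇒formula (fin m) len≡m = ⊩-resp-≈ₚ (chain lastBlock m 0) (drop-zero π)
          (contraction⇒chain lastBlock m (valid-zero _) block-zero (+-identityʳ m)
            (subst (λ l → Valid l m) (sym len≡m) ≤-refl) (contraction⇒lastBlock len≡m))
        contraction⇒formula inf len≡inf n = ⊩-resp-≈ₚ (chain inBlock n 0) (drop-zero π)
          (contraction⇒chain inBlock n (valid-zero _) block-zero (+-identityʳ n)
            (subst (λ l → Valid l n) (sym len≡inf) tt) (λ _ vi′ → in-block vi′))

      -- A path satisfying the trace formula of τ contracts to τ because any contraction τ′ of it
      -- agrees with τ up to ≋.
      module _ {π : Path K} (stutter-free-τ : StutterFree 𝒞≋ τ)
               {τ′ : Trace K 𝒞≋} (c′ : IsContraction K 𝒞≋ π τ′) where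
        open Contraction 𝒞≋ {π} {τ′} c′

        Matches : ℕ → Set₁
        Matches x = Valid (tlen τ′) x × lower (tcol τ′ x) ≋ col x

        matches : ∀ {i j} (vi : Valid (len π) i) → block i ≡ j → at π i ⊨ χ (col j) → Matches j
        matches {i} vi refl h =
          block-valid i vi , ≋-trans (≋-sym (block-colour i vi)) (≋-sym (χ⇒≋ h))

        block-constant : ∀ {u i k} (vk : Valid (len π) k) → i ≤ k →
          (∀ m → Valid (len π) m → i ≤ m → m ≤ k → at π m ⊨ χ u) → block k ≡ block i
        block-constant {k = zero}  _  z≤n   _        = refl
        block-constant {k = suc k} vk i≤1+k all-in-u with m≤n⇒m<n∨m≡n i≤1+k
        ... | inj₂ refl  = refl
        ... | inj₁ i<1+k =
          trans (stays k vk (χ-common⇒≋ (all-in-u k vk′ i≤k (n≤1+n k))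
                                         (all-in-u (suc k) vk (<⇒≤ i<1+k) ≤-refl)))
                (block-constant vk′ i≤k λ m vm i≤m m≤k → all-in-u m vm i≤m (m≤n⇒m≤1+n m≤k))
          where
            vk′ = valid-pred _ vk
            i≤k = ≤-pred i<1+k

        chain⇒matching : ∀ B → Head B → ∀ d {j n i} (vi : Valid (len π) i) → block i ≡ j →
          d + j ≡ n → Valid (tlen τ) n → drop K π i vi ⊩ chain B d j →
          (∀ x → j ≤ x → x ≤ n → Matches x) ×
          Σ[ i* ∈ ℕ ] Σ[ vi* ∈ Valid (len π) i* ] (block i* ≡ n × drop K π i* vi* ⊩ B n)
        chain⇒matching B head zero vi bi≡j refl _ h =
          (λ x j≤x x≤j → subst Matches (≤-antisym j≤x x≤j) (matches vi bi≡j (head _ _ h))) ,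
          _ , vi , bi≡j , h
        chain⇒matching B head (suc d) {j} {_} {i} vi bi≡j refl vn h
          with U-elim {π} {inBlock j} {chain B d (suc j)} vi (h false)
        ... | k , vk , i≤k , next , during = all-match , proj₂ rest
          where
            here : at π i ⊨ χ (col j)
            here = h true
            there : at π k ⊨ χ (col (suc j))
            there = chain-head B head d (suc j) _ next
            distinct : ∀ {w w′} → w ⊨ χ (col j) → w′ ⊨ χ (col (suc j)) → ¬ w ≋ w′
            distinct hw hw′ w≋w′ =
              stutter-free-τ j (valid-≤ (tlen τ) (s≤s (m≤n+m j d)) vn) (χ-reflects-≋ hw hw′ w≋w′)
            entered : ∀ k (vk : Valid (len π) k) → i < k →
              (∀ m (vm : Valid (len π) m) → i ≤ m → m < k → drop K π m vm ⊩ inBlock j) →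
              at π k ⊨ χ (col (suc j)) → block k ≡ suc j
            entered (suc k′) vk (s≤s i≤k′) during there =
              trans (moves k′ vk (distinct (during k′ vk′ i≤k′ ≤-refl) there)) (cong suc bk′≡j)
              where
                vk′ = valid-pred _ vk
                bk′≡j = trans (block-constant vk′ i≤k′ λ m vm i≤m m≤k′ → during m vm i≤m (s≤s m≤k′))
                              bi≡j
            bk≡1+j : block k ≡ suc j
            bk≡1+j with m≤n⇒m<n∨m≡n i≤k
            ... | inj₁ i<k = entered k vk i<k during there
            ... | inj₂ refl = ⊥-elim (distinct here there ≋-refl)
            rest = chain⇒matching B head d vk bk≡1+j (+-suc d j) vn next
            all-match : ∀ x → j ≤ x → x ≤ suc (d + j) → Matches x
            all-match x j≤x x≤n with m≤n⇒m<n∨m≡n j≤x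
            ... | inj₁ j<x  = proj₁ rest x j<x x≤n
            ... | inj₂ refl = matches vi bi≡j here

        formula⇒contraction : ∀ l → tlen τ ≡ l → π ⊩ formulaFor l → IsContraction K 𝒞≋ π τ
        formula⇒contraction (fin n) len≡n h
          with chain⇒matching lastBlock (λ _ _ h → h true) n (valid-zero _) block-zero (+-identityʳ n)
                 (subst (λ l → Valid l n) (sym len≡n) ≤-refl)
                 (⊩-resp-≈ₚ (chain lastBlock n 0) (≈ₚ-sym (drop-zero π)) h)
        ... | all-match , i* , vi* , bi*≡n , last =
          contraction-resp 𝒞≋ {π} {τ′} {τ} c′
            (trans (trace-length (proj₁ (all-match n z≤n ≤-refl)) bounded) (sym len≡n))
            (λ x vx → proj₂ (all-match x z≤n (subst (λ l → Valid l x) len≡n vx))) stutter-free-τ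
          where
            remains : ∀ k (vk : Valid (len π) k) → i* ≤ k → at π k ⊨ χ (col n)
            remains k vk i*≤k =
              decidable-stable decide (□-elim {π} {inBlock n} vi* vk i*≤k (last false))
            bounded : ∀ i → Valid (len π) i → block i ≤ n
            bounded i vi with i ≤? i*
            ... | yes i≤i* = subst (block i ≤_) bi*≡n (monotone block-step i≤i* vi*)
            ... | no  i≰i* = ≤-reflexive (trans
                    (block-constant vi (<⇒≤ (≰⇒> i≰i*)) λ m vm i*≤m _ → remains m vm i*≤m) bi*≡n)
        formula⇒contraction inf len≡inf h =
          contraction-resp 𝒞≋ {π} {τ′} {τ} c′
            (trans (valid-everywhere⇒inf _ (λ x → proj₁ (match x))) (sym len≡inf))
            (λ x _ → proj₂ (match x)) stutter-free-τ
          where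
            match : ∀ x → Matches x
            match x = proj₁ (chain⇒matching inBlock (λ _ _ h → h) x (valid-zero _) block-zero
                        (+-identityʳ x) (subst (λ l → Valid l x) (sym len≡inf) tt)
                        (⊩-resp-≈ₚ (chain inBlock x 0) (≈ₚ-sym (drop-zero π)) (h x))) x z≤n ≤-refl

    trace-transfer : ∀ {s t} → s ≋ t → ∀ τ → IsTraceOf K 𝒞≋ s τ → IsTraceOf K 𝒞≋ t τ
    trace-transfer s≋t τ (π , π-from-s , c) =
      let π′ , π′-from-t , h =
            Equivalence.to (s≋t (∃ₚ formula)) (π , π-from-s , contraction⇒formula c (tlen τ) refl)
      in  π′ , π′-from-t , formula⇒contraction (Contraction.stutter-free 𝒞≋ {π} {τ} c)
                                               (proj₂ (contraction 𝒞≋ em π′)) (tlen τ) refl h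
      where open TraceFormula τ

    𝒞≋-consistent : Consistent K 𝒞≋
    𝒞≋-consistent s t s≋t =
      (λ p → s≋t (atom p)) , λ τ → mk⇔ (trace-transfer s≋t τ) (trace-transfer (≋-sym s≋t) τ)

theorem2p7 : ExcludedMiddle (lsuc (lsuc 0ℓ)) →
    (AP : Set) (K : Kripke AP) (s t : Kripke.S K) →
    _≈dbs_ K s t ⇔ (∀ (φ : StateF AP) → (_⊨ₛ_ K s φ ⇔ _⊨ₛ_ K t φ))
theorem2p7 em AP K s t = mk⇔ sound complete
  where
    em₁ : ExcludedMiddle (lsuc 0ℓ)
    em₁ = em-lower {b = lsuc (lsuc 0ℓ)} em
    open Completeness K em₁ using (_≋_; 𝒞≋; 𝒞≋-consistent)

    sound : _≈dbs_ K s t → s ≋ t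
    sound (𝒞 , consistent , s≈t) φ =
      mk⇔ (⊨-resp-colour φ s≈t) (⊨-resp-colour φ (Setoid.sym (Colouring.Colours 𝒞) s≈t))
      where open Preservation K 𝒞 em₁ consistent

    complete : s ≋ t → _≈dbs_ K s t
    complete s≋t = 𝒞≋ , 𝒞≋-consistent , s≋t
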